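{- Let $\pi$ be an $\mathbf{mL^3}$ proof net with $\pi\to\pi'$. Then the level of $\pi'$ is at most the level of $\pi$.
   Context: meLL proof nets are the usual sequentializable proof nets of second-order multiplicative exponential linear logic with paragraph modality (links: axiom, cut, tensor, par, for all, exists, paragraph, of course, flat, pax, why not; exponential boxes), possibly untyped, with standard cut elimination $\to$. An indexing is a map $I$ from edges to $\mathbb Z$ such that axiom conclusions, cut premises, and premises/conclusion of tensor, par, for all, exists, pax and why not links have equal index, the premise of an of course, paragraph or flat link has index one more than its conclusion, and all conclusions of the net have equal index. $\mathbf{mL^3}$ = meLL proof nets admitting an indexing. The canonical indexing is the unique indexing that is $\ge0$ everywhere and vanishes on some edge of each connected component; the level of a proof net is the maximum value of its canonical indexing. -}

module Defs where

open import Data.Nat as ℕ using (ℕ; zero; suc; _≡ᵇ_)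
open import Data.Integer as ℤ using (ℤ; 0ℤ; 1ℤ; _⊔_)
open import Data.Bool using (if_then_else_)
open import Data.List using (List; []; _∷_; _++_; map; foldr; upTo; length; zipWith; concatMap)
open import Data.List.Membership.Propositional using (_∈_; _∉_)
open import Data.List.Relation.Unary.All using (All)
open import Data.List.Relation.Unary.Unique.Propositional using (Unique)
open import Data.List.Relation.Binary.Permutation.Propositional using (_↭_)
open import Data.Product using (Σ; ∃; _×_; _,_; proj₁; proj₂)
open import Data.Sum using (_⊎_)
open import Data.Unit using (⊤)
open import Relation.Binary.PropositionalEquality using (_≡_; _≢_)
open import Relation.Binary.Construct.Closure.ReflexiveTransitive using (Star)

-- A box is a
-- single constructor bundling its "of course" link (premise a, conclusion
-- c), its auxiliary doors (pax links, list of (premise , conclusion)) and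
-- its contents (a list of links, which may again contain boxes).

data Link : Set where
  axL   : ℕ → ℕ → Link
  cutL  : ℕ → ℕ → Link
  tensL : ℕ → ℕ → ℕ → Link             -- tensor: premises, conclusion
  parL  : ℕ → ℕ → ℕ → Link             -- par: premises, conclusion
  allL  : ℕ → ℕ → Link                 -- for all: premise, conclusion
  exL   : ℕ → ℕ → Link                 -- exists: premise, conclusion
  paraL : ℕ → ℕ → Link                 -- paragraph: premise, conclusion
  flatL : ℕ → ℕ → Link                 -- flat: premise, conclusion
  wnL   : List ℕ → ℕ → Link            -- why not (n-ary): premises, conclusion
  boxL  : List Link → ℕ → ℕ → List (ℕ × ℕ) → Link
          -- boxL contents a c paxes : of course link a ↦ c, pax links p ↦ q

paxEdges : List (ℕ × ℕ) → List ℕ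
paxEdges = concatMap (λ pq → proj₁ pq ∷ proj₂ pq ∷ [])

mutual
  edgesL : List Link → List ℕ
  edgesL [] = []
  edgesL (l ∷ ls) = edgesK l ++ edgesL ls

  edgesK : Link → List ℕ
  edgesK (axL a b) = a ∷ b ∷ []
  edgesK (cutL a b) = a ∷ b ∷ []
  edgesK (tensL a b c) = a ∷ b ∷ c ∷ []
  edgesK (parL a b c) = a ∷ b ∷ c ∷ []
  edgesK (allL a c) = a ∷ c ∷ []
  edgesK (exL a c) = a ∷ c ∷ []
  edgesK (paraL a c) = a ∷ c ∷ []
  edgesK (flatL a c) = a ∷ c ∷ []
  edgesK (wnL es c) = c ∷ es
  edgesK (boxL B a c ps) = a ∷ c ∷ paxEdges ps ++ edgesL B

mutual
  -- the edge sets of the individual links (of course and pax links of a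
  -- box are separate links), at every depth; used for connectivity
  atomsL : List Link → List (List ℕ)
  atomsL [] = []
  atomsL (l ∷ ls) = atomsK l ++ atomsL ls

  atomsK : Link → List (List ℕ)
  atomsK (boxL B a c ps) =
    (a ∷ c ∷ []) ∷ map (λ pq → proj₁ pq ∷ proj₂ pq ∷ []) ps ++ atomsL B
  atomsK l = edgesK l ∷ []

renP : (ℕ → ℕ) → List (ℕ × ℕ) → List (ℕ × ℕ)
renP f = map (λ pq → f (proj₁ pq) , f (proj₂ pq))

mutual
  renL : (ℕ → ℕ) → List Link → List Link
  renL f [] = []
  renL f (l ∷ ls) = renK f l ∷ renL f ls

  renK : (ℕ → ℕ) → Link → Link
  renK f (axL a b) = axL (f a) (f b)
  renK f (cutL a b) = cutL (f a) (f b)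
  renK f (tensL a b c) = tensL (f a) (f b) (f c)
  renK f (parL a b c) = parL (f a) (f b) (f c)
  renK f (allL a c) = allL (f a) (f c)
  renK f (exL a c) = exL (f a) (f c)
  renK f (paraL a c) = paraL (f a) (f c)
  renK f (flatL a c) = flatL (f a) (f c)
  renK f (wnL es c) = wnL (map f es) (f c)
  renK f (boxL B a c ps) = boxL (renL f B) (f a) (f c) (renP f ps)

-- Sequentializability: the proof structures obtained by translating
-- (untyped) sequent calculus derivations, up to order of links and of
-- conclusions.

_#_ : ℕ → List Link → Set
x # L = x ∉ edgesL L

Disjoint : List Link → List Link → Set
Disjoint L₁ L₂ = ∀ x → x ∈ edgesL L₁ → x ∉ edgesL L₂

data Seq : List Link → List ℕ → Set where
  s-ax   : ∀ {a b} → a ≢ b → Seq (axL a b ∷ []) (a ∷ b ∷ [])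
  s-cut  : ∀ {L₁ L₂ a b Γ Δ} → Seq L₁ (a ∷ Γ) → Seq L₂ (b ∷ Δ) → Disjoint L₁ L₂ →
           Seq (cutL a b ∷ L₁ ++ L₂) (Γ ++ Δ)
  s-tens : ∀ {L₁ L₂ a b c Γ Δ} → Seq L₁ (a ∷ Γ) → Seq L₂ (b ∷ Δ) → Disjoint L₁ L₂ →
           c # L₁ → c # L₂ → Seq (tensL a b c ∷ L₁ ++ L₂) (c ∷ Γ ++ Δ)
  s-par  : ∀ {L a b c Γ} → Seq L (a ∷ b ∷ Γ) → c # L → Seq (parL a b c ∷ L) (c ∷ Γ)
  s-all  : ∀ {L a c Γ} → Seq L (a ∷ Γ) → c # L → Seq (allL a c ∷ L) (c ∷ Γ)
  s-ex   : ∀ {L a c Γ} → Seq L (a ∷ Γ) → c # L → Seq (exL a c ∷ L) (c ∷ Γ)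
  s-para : ∀ {L a c Γ} → Seq L (a ∷ Γ) → c # L → Seq (paraL a c ∷ L) (c ∷ Γ)
  s-flat : ∀ {L a c Γ} → Seq L (a ∷ Γ) → c # L → Seq (flatL a c ∷ L) (c ∷ Γ)
  s-wn   : ∀ {L es c Γ} → Seq L (es ++ Γ) → c # L → Seq (wnL es c ∷ L) (c ∷ Γ)
  s-box  : ∀ {L a c ps} → Seq L (a ∷ map proj₁ ps) → c # L →
           All (_# L) (map proj₂ ps) → Unique (c ∷ map proj₂ ps) →
           Seq (boxL L a c ps ∷ []) (c ∷ map proj₂ ps)
  s-exch : ∀ {L Γ Δ} → Seq L Γ → Γ ↭ Δ → Seq L Δ
  s-perm : ∀ {L L' Γ} → Seq L Γ → L ↭ L' → Seq L' Γ

record Net : Set where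
  constructor net
  field
    links : List Link
    concl : List ℕ
    seq   : Seq links concl
open Net public

edges : Net → List ℕ
edges π = edgesL (links π)

IsCut : Link → ℕ → ℕ → Set
IsCut l x y = (l ≡ cutL x y) ⊎ (l ≡ cutL y x)

IsAx : Link → ℕ → ℕ → Set
IsAx l x y = (l ≡ axL x y) ⊎ (l ≡ axL y x)

subst1 : ℕ → ℕ → ℕ → ℕ
subst1 c a x = if x ≡ᵇ c then a else x

-- identify each pax premise with its pax conclusion (box opening)
paxSubst : List (ℕ × ℕ) → ℕ → ℕ
paxSubst [] x = x
paxSubst ((p , q) ∷ ps) x = if x ≡ᵇ p then q else paxSubst ps x

-- j-th, (j+1)-th, ... copies of a box, copy i renamed by f i and its
-- principal conclusion cut against the i-th premise of the why not link
copies : (ℕ → ℕ → ℕ) → List Link → ℕ → ℕ → List (ℕ × ℕ) → ℕ → List ℕ → List Link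
copies f B a c ps j [] = []
copies f B a c ps j (e ∷ es) =
  boxL (renL (f j) B) (f j a) (f j c) (renP (f j) ps) ∷ cutL (f j c) e ∷
  copies f B a c ps (suc j) es

-- the new why not links gathering the k copies of each auxiliary door
contractions : (ℕ → ℕ → ℕ) → List (ℕ × ℕ) → ℕ → List Link
contractions f ps k = map (λ pq → wnL (map (λ j → f j (proj₂ pq)) (upTo k)) (proj₂ pq)) ps

-- a set U of already used edge names (those of the whole net)
data Base (U : List ℕ) : List Link → List Link → Set where
  r-ax   : ∀ {L L' R al cl a b c} → IsAx al a b → IsCut cl b c →
           L ↭ al ∷ cl ∷ R → L' ↭ renL (subst1 c a) R → Base U L L'
  r-mult : ∀ {L L' R cl a b c a' b' d} → IsCut cl c d →
           L ↭ cl ∷ tensL a b c ∷ parL a' b' d ∷ R →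
           L' ↭ cutL a a' ∷ cutL b b' ∷ R → Base U L L'
  r-quant : ∀ {L L' R cl a b c d} → IsCut cl c d →
           L ↭ cl ∷ allL a c ∷ exL b d ∷ R → L' ↭ cutL a b ∷ R → Base U L L'
  r-para : ∀ {L L' R cl a b c d} → IsCut cl c d →
           L ↭ cl ∷ paraL a c ∷ paraL b d ∷ R → L' ↭ cutL a b ∷ R → Base U L L'
  -- of course box / why not (k premises): k fresh copies of the box,
  -- auxiliary doors gathered by new why not links (k = 0: erasure)
  r-dup  : ∀ {L L' R cl B a c ps es d} → IsCut cl c d →
           L ↭ cl ∷ boxL B a c ps ∷ wnL es d ∷ R →
           (f : ℕ → ℕ → ℕ) →
           (∀ j x j' x' → f j x ≡ f j' x' → (j ≡ j') × (x ≡ x')) →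
           (∀ j x → f j x ∉ U) →
           L' ↭ copies f B a c ps 0 es ++ contractions f ps (length es) ++ R →
           Base U L L'
  r-flat : ∀ {L L' R cl B a c ps g d} → IsCut cl c d →
           L ↭ cl ∷ boxL B a c ps ∷ flatL g d ∷ R →
           L' ↭ cutL a g ∷ renL (paxSubst ps) B ++ R → Base U L L'
  -- of course box / auxiliary door of another box: the first box
  -- enters the second one (rs: fresh names for the new auxiliary doors)
  r-comm : ∀ {L L' R cl B a c ps B₂ a₂ c₂ ps₂ qs₂ p d rs} → IsCut cl c d →
           L ↭ cl ∷ boxL B a c ps ∷ boxL B₂ a₂ c₂ ps₂ ∷ R →
           ps₂ ↭ (p , d) ∷ qs₂ →
           length rs ≡ length ps → Unique rs → All (_∉ U) rs →
           L' ↭ boxL (cutL c p ∷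
                       boxL B a c (zipWith (λ pq r → proj₁ pq , r) ps rs) ∷ B₂)
                     a₂ c₂ (zipWith (λ pq r → r , proj₂ pq) ps rs ++ qs₂) ∷ R →
           Base U L L'

data Step (U : List ℕ) : List Link → List Link → Set where
  base  : ∀ {L L'} → Base U L L' → Step U L L'
  inbox : ∀ {L L' R B B' a c ps} → L ↭ boxL B a c ps ∷ R → Step U B B' →
          L' ↭ boxL B' a c ps ∷ R → Step U L L'

infix 4 _⟶_
_⟶_ : Net → Net → Set
π ⟶ π' = Step (edges π) (links π) (links π') × (concl π' ≡ concl π)

mutual
  IdxL : (ℕ → ℤ) → List Link → Set
  IdxL I [] = ⊤
  IdxL I (l ∷ ls) = IdxK I l × IdxL I ls

  IdxK : (ℕ → ℤ) → Link → Set
  IdxK I (axL a b) = I a ≡ I b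
  IdxK I (cutL a b) = I a ≡ I b
  IdxK I (tensL a b c) = (I a ≡ I c) × (I b ≡ I c)
  IdxK I (parL a b c) = (I a ≡ I c) × (I b ≡ I c)
  IdxK I (allL a c) = I a ≡ I c
  IdxK I (exL a c) = I a ≡ I c
  IdxK I (paraL a c) = I a ≡ I c ℤ.+ 1ℤ
  IdxK I (flatL a c) = I a ≡ I c ℤ.+ 1ℤ
  IdxK I (wnL es c) = All (λ e → I e ≡ I c) es
  IdxK I (boxL B a c ps) =
    (I a ≡ I c ℤ.+ 1ℤ) × All (λ pq → I (proj₁ pq) ≡ I (proj₂ pq)) ps × IdxL I B

Indexing : Net → (ℕ → ℤ) → Set
Indexing π I = IdxL I (links π) × (∀ x y → x ∈ concl π → y ∈ concl π → I x ≡ I y)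

mL3 : Net → Set
mL3 π = Σ (ℕ → ℤ) (Indexing π)

-- adjacency: two edges of a common link; conclusions of the net are
-- regarded as attached to a common conclusion node
Adj : Net → ℕ → ℕ → Set
Adj π x y = (Σ (List ℕ) λ g → g ∈ atomsL (links π) × x ∈ g × y ∈ g)
          ⊎ (x ∈ concl π × y ∈ concl π)

Connected : Net → ℕ → ℕ → Set
Connected π = Star (Adj π)

Canonical : Net → (ℕ → ℤ) → Set
Canonical π I =
  Indexing π I ×
  (∀ x → x ∈ edges π → 0ℤ ℤ.≤ I x) ×
  (∀ x → x ∈ edges π → Σ ℕ λ y → y ∈ edges π × Connected π x y × I y ≡ 0ℤ)

-- maximum value of an indexing on the edges of the net (0 if no edges)
level : Net → (ℕ → ℤ) → ℤ
level π I = foldr _⊔_ 0ℤ (map I (edges π))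

module Submission where

-- Cut elimination does not raise the level of an mL³ proof net, because a step never
-- needs an index value that did not already occur.
--
-- For every step L ⟶ L' (at any depth) and every indexing I
--    of L there is an indexing J of L' that agrees with I on all names already in use and
--    whose value on each edge of L' is the value of I on some edge of L: every edge of L' is
--    an old edge, an old edge renamed (axiom step, box opening), or a fresh copy of an old
--    edge (duplication, box commutation) and simply inherits that edge's index.
-- 2. Normalisation (`normalise`).  An indexing J of a net that is ≥ 0 on its edges becomes
--    canonical after subtracting on each edge the minimum of J over its connected component;
--    the result is ≤ J.  Computing that minimum uses decidable reachability, obtained by a
--    path search over the finite set of edges.
-- 3. The theorem.  Transport the canonical indexing of π along the step; the result is ≥ 0
--    and bounded by level π I on the edges of π', since its values are values of I.  Its
--    normalisation is canonical and still bounded, hence so is its maximum.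

open import Defs
open import Function using (_∘_)
open import Data.Bool using (true; false; T)
open import Data.Nat as ℕ using (ℕ; zero; suc; _≡ᵇ_; _<_; s≤s)
open import Data.Nat.Properties using (≡ᵇ⇒≡; +-identityʳ; +-suc)
open import Data.Integer as ℤ using (ℤ; 0ℤ; 1ℤ; _+_; _-_; _⊓_; _⊔_; _≤_)
import Data.Integer.Properties as ℤP
open import Data.Integer.Tactic.RingSolver using (solve-∀)
open import Data.List using (List; []; _∷_; _++_; map; foldr; upTo; length; zipWith)
open import Data.List.Properties using (++-assoc; map-id)
open import Data.List.Membership.Propositional using (_∈_; _∉_)
open import Data.List.Membership.Propositional.Properties
  using (∈-++⁺ˡ; ∈-++⁺ʳ; ∈-++⁻; ∈-map⁺; ∈-map⁻; ∈-applyUpTo⁻)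
open import Data.List.Membership.DecPropositional ℕ._≟_ using (_∈?_)
open import Data.List.Relation.Binary.Subset.Propositional using (_⊆_)
open import Data.List.Relation.Unary.All as All using (All; []; _∷_)
import Data.List.Relation.Unary.All.Properties as AllP
open import Data.List.Relation.Unary.Any using (Any; here; there)
open import Data.List.Relation.Unary.Unique.Propositional using (Unique)
open import Data.List.Relation.Unary.AllPairs using ([]; _∷_)
open import Data.List.Relation.Binary.Permutation.Propositional using (_↭_; ↭-sym)
open import Data.List.Relation.Binary.Permutation.Propositional.Properties
  using (All-resp-↭; Any-resp-↭; ∈-resp-↭)
open import Data.Product using (Σ; ∃; _×_; _,_; proj₁; proj₂)
open import Data.Sum as Sum using (_⊎_; inj₁; inj₂; [_,_]′)
open import Data.Unit using (tt)
open import Data.Empty using (⊥-elim)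
open import Relation.Nullary using (Dec; yes; no)
open import Relation.Binary.PropositionalEquality hiding (J)
open import Relation.Binary.Construct.Closure.ReflexiveTransitive using (Star; ε; _◅_; _◅◅_; reverse)

edgesL-++ : ∀ L R → edgesL (L ++ R) ≡ edgesL L ++ edgesL R
edgesL-++ [] R = refl
edgesL-++ (l ∷ L) R =
  trans (cong (edgesK l ++_) (edgesL-++ L R)) (sym (++-assoc (edgesK l) (edgesL L) (edgesL R)))

∈edges-++⁺ʳ : ∀ L R → edgesL R ⊆ edgesL (L ++ R)
∈edges-++⁺ʳ L R m = subst (_ ∈_) (sym (edgesL-++ L R)) (∈-++⁺ʳ (edgesL L) m)

∈edges-++⁺ˡ : ∀ L R → edgesL L ⊆ edgesL (L ++ R)
∈edges-++⁺ˡ L R m = subst (_ ∈_) (sym (edgesL-++ L R)) (∈-++⁺ˡ m)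

∈edges-++⁻ : ∀ {x} L R → x ∈ edgesL (L ++ R) → x ∈ edgesL L ⊎ x ∈ edgesL R
∈edges-++⁻ L R m = ∈-++⁻ (edgesL L) (subst (_ ∈_) (edgesL-++ L R) m)

∈edges⇒Any : ∀ {x} L → x ∈ edgesL L → Any (λ l → x ∈ edgesK l) L
∈edges⇒Any (l ∷ L) m with ∈-++⁻ (edgesK l) m
... | inj₁ p = here p
... | inj₂ p = there (∈edges⇒Any L p)

Any⇒∈edges : ∀ {x} L → Any (λ l → x ∈ edgesK l) L → x ∈ edgesL L
Any⇒∈edges (l ∷ L) (here p) = ∈-++⁺ˡ p
Any⇒∈edges (l ∷ L) (there p) = ∈-++⁺ʳ (edgesK l) (Any⇒∈edges L p)

∈edges-↭ : ∀ {L L'} → L ↭ L' → edgesL L ⊆ edgesL L'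
∈edges-↭ {L} {L'} p m = Any⇒∈edges L' (Any-resp-↭ p (∈edges⇒Any L m))

box∈a : ∀ B a c ps → a ∈ edgesK (boxL B a c ps)
box∈a B a c ps = here refl

box∈c : ∀ B a c ps → c ∈ edgesK (boxL B a c ps)
box∈c B a c ps = there (here refl)

box∈pax : ∀ B a c ps → paxEdges ps ⊆ edgesK (boxL B a c ps)
box∈pax B a c ps m = there (there (∈-++⁺ˡ m))

box∈contents : ∀ B a c ps → edgesL B ⊆ edgesK (boxL B a c ps)
box∈contents B a c ps m = there (there (∈-++⁺ʳ (paxEdges ps) m))

pax∈₁ : ∀ {p q} ps → (p , q) ∈ ps → p ∈ paxEdges ps
pax∈₁ (_ ∷ ps) (here refl) = here refl
pax∈₁ (_ ∷ ps) (there m) = there (there (pax∈₁ ps m))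

pax∈₂ : ∀ {p q} ps → (p , q) ∈ ps → q ∈ paxEdges ps
pax∈₂ (_ ∷ ps) (here refl) = there (here refl)
pax∈₂ (_ ∷ ps) (there m) = there (there (pax∈₂ ps m))

pax∈⁻ : ∀ ps {x} → x ∈ paxEdges ps → ∃ λ pq → pq ∈ ps × (x ≡ proj₁ pq ⊎ x ≡ proj₂ pq)
pax∈⁻ ((p , q) ∷ ps) (here refl) = (p , q) , here refl , inj₁ refl
pax∈⁻ ((p , q) ∷ ps) (there (here refl)) = (p , q) , here refl , inj₂ refl
pax∈⁻ ((p , q) ∷ ps) (there (there m)) with pax∈⁻ ps m
... | pq , mpq , e = pq , there mpq , e

-- IdxL is the pointwise predicate All (IdxK I), so it is insensitive to the order of links.
IdxL⇒All : ∀ {I} L → IdxL I L → All (IdxK I) L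
IdxL⇒All [] _ = []
IdxL⇒All (l ∷ L) (p , q) = p ∷ IdxL⇒All L q

All⇒IdxL : ∀ {I} L → All (IdxK I) L → IdxL I L
All⇒IdxL [] _ = tt
All⇒IdxL (l ∷ L) (p ∷ q) = p , All⇒IdxL L q

IdxL-↭ : ∀ {I L L'} → L ↭ L' → IdxL I L → IdxL I L'
IdxL-↭ {L = L} {L'} p i = All⇒IdxL L' (All-resp-↭ p (IdxL⇒All L i))

IdxL-++ : ∀ {I} L R → IdxL I L → IdxL I R → IdxL I (L ++ R)
IdxL-++ [] R _ r = r
IdxL-++ (l ∷ L) R (p , q) r = p , IdxL-++ L R q r

Carries : (ℕ → ℕ) → (ℕ → ℤ) → (ℕ → ℤ) → List ℕ → Set
Carries g I J E = ∀ {x} → x ∈ E → J (g x) ≡ I x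

module _ {I J : ℕ → ℤ} (g : ℕ → ℕ) where

  carry-≡ : ∀ {x y} → J (g x) ≡ I x → J (g y) ≡ I y → I x ≡ I y → J (g x) ≡ J (g y)
  carry-≡ ex ey e = trans ex (trans e (sym ey))

  carry-+1 : ∀ {x y} → J (g x) ≡ I x → J (g y) ≡ I y → I x ≡ I y + 1ℤ → J (g x) ≡ J (g y) + 1ℤ
  carry-+1 ex ey e = trans ex (trans e (cong (_+ 1ℤ) (sym ey)))

  carry-pax : ∀ ps → Carries g I J (paxEdges ps) →
    All (λ pq → I (proj₁ pq) ≡ I (proj₂ pq)) ps → All (λ pq → J (proj₁ pq) ≡ J (proj₂ pq)) (renP g ps)
  carry-pax [] H [] = []
  carry-pax ((p , q) ∷ ps) H (e ∷ es) =
    carry-≡ (H (here refl)) (H (there (here refl))) e ∷ carry-pax ps (H ∘ there ∘ there) es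

  carry-wn : ∀ c es → Carries g I J (c ∷ es) →
    All (λ e → I e ≡ I c) es → All (λ e → J e ≡ J (g c)) (map g es)
  carry-wn c [] H [] = []
  carry-wn c (e ∷ es) H (p ∷ ps) =
    carry-≡ (H (there (here refl))) (H (here refl)) p ∷ carry-wn c es H' ps
    where
    H' : Carries g I J (c ∷ es)
    H' (here q) = H (here q)
    H' (there m) = H (there (there m))

  mutual
    renIdxL : ∀ L → Carries g I J (edgesL L) → IdxL I L → IdxL J (renL g L)
    renIdxL [] H _ = tt
    renIdxL (l ∷ L) H (p , q) = renIdxK l (H ∘ ∈-++⁺ˡ) p , renIdxL L (H ∘ ∈-++⁺ʳ (edgesK l)) q

    renIdxK : ∀ l → Carries g I J (edgesK l) → IdxK I l → IdxK J (renK g l)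
    renIdxK (axL a b) H p = carry-≡ (H (here refl)) (H (there (here refl))) p
    renIdxK (cutL a b) H p = carry-≡ (H (here refl)) (H (there (here refl))) p
    renIdxK (tensL a b c) H (p , q) =
      carry-≡ (H (here refl)) (H (there (there (here refl)))) p ,
      carry-≡ (H (there (here refl))) (H (there (there (here refl)))) q
    renIdxK (parL a b c) H (p , q) =
      carry-≡ (H (here refl)) (H (there (there (here refl)))) p ,
      carry-≡ (H (there (here refl))) (H (there (there (here refl)))) q
    renIdxK (allL a c) H p = carry-≡ (H (here refl)) (H (there (here refl))) p
    renIdxK (exL a c) H p = carry-≡ (H (here refl)) (H (there (here refl))) p
    renIdxK (paraL a c) H p = carry-+1 (H (here refl)) (H (there (here refl))) p
    renIdxK (flatL a c) H p = carry-+1 (H (here refl)) (H (there (here refl))) p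
    renIdxK (wnL es c) H p = carry-wn c es H p
    renIdxK (boxL B a c ps) H (p , q , r) =
      carry-+1 (H (box∈a B a c ps)) (H (box∈c B a c ps)) p ,
      carry-pax ps (H ∘ box∈pax B a c ps) q ,
      renIdxL B (H ∘ box∈contents B a c ps) r

mutual
  renL-id : ∀ L → renL (λ x → x) L ≡ L
  renL-id [] = refl
  renL-id (l ∷ L) = cong₂ _∷_ (renK-id l) (renL-id L)

  renK-id : ∀ l → renK (λ x → x) l ≡ l
  renK-id (axL a b) = refl
  renK-id (cutL a b) = refl
  renK-id (tensL a b c) = refl
  renK-id (parL a b c) = refl
  renK-id (allL a c) = refl
  renK-id (exL a c) = refl
  renK-id (paraL a c) = refl
  renK-id (flatL a c) = refl
  renK-id (wnL es c) = cong (λ z → wnL z c) (map-id es)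
  renK-id (boxL B a c ps) = cong₂ (λ X Y → boxL X a c Y) (renL-id B) (map-id ps)

reindexK : ∀ {I J : ℕ → ℤ} l → Carries (λ x → x) I J (edgesK l) → IdxK I l → IdxK J l
reindexK {J = J} l H p = subst (IdxK J) (renK-id l) (renIdxK (λ x → x) l H p)

reindexL : ∀ {I J : ℕ → ℤ} L → Carries (λ x → x) I J (edgesL L) → IdxL I L → IdxL J L
reindexL {J = J} L H p = subst (IdxL J) (renL-id L) (renIdxL (λ x → x) L H p)

∈pax-ren⇒image : ∀ (g : ℕ → ℕ) ps {y} → y ∈ paxEdges (renP g ps) → ∃ λ x → x ∈ paxEdges ps × y ≡ g x
∈pax-ren⇒image g ((p , q) ∷ ps) (here refl) = p , here refl , refl
∈pax-ren⇒image g ((p , q) ∷ ps) (there (here refl)) = q , there (here refl) , refl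
∈pax-ren⇒image g ((p , q) ∷ ps) (there (there m)) with ∈pax-ren⇒image g ps m
... | x , mx , e = x , there (there mx) , e

mutual
  ∈renL⇒image : ∀ (g : ℕ → ℕ) L {y} → y ∈ edgesL (renL g L) → ∃ λ x → x ∈ edgesL L × y ≡ g x
  ∈renL⇒image g (l ∷ L) m with ∈-++⁻ (edgesK (renK g l)) m
  ... | inj₁ p = let (x , mx , e) = ∈renK⇒image g l p in x , ∈-++⁺ˡ mx , e
  ... | inj₂ p = let (x , mx , e) = ∈renL⇒image g L p in x , ∈-++⁺ʳ (edgesK l) mx , e

  ∈renK⇒image : ∀ (g : ℕ → ℕ) l {y} → y ∈ edgesK (renK g l) → ∃ λ x → x ∈ edgesK l × y ≡ g x
  ∈renK⇒image g (axL a b) m = ∈-map⁻ g m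
  ∈renK⇒image g (cutL a b) m = ∈-map⁻ g m
  ∈renK⇒image g (tensL a b c) m = ∈-map⁻ g m
  ∈renK⇒image g (parL a b c) m = ∈-map⁻ g m
  ∈renK⇒image g (allL a c) m = ∈-map⁻ g m
  ∈renK⇒image g (exL a c) m = ∈-map⁻ g m
  ∈renK⇒image g (paraL a c) m = ∈-map⁻ g m
  ∈renK⇒image g (flatL a c) m = ∈-map⁻ g m
  ∈renK⇒image g (wnL es c) m = ∈-map⁻ g m
  ∈renK⇒image g (boxL B a c ps) (here refl) = a , box∈a B a c ps , refl
  ∈renK⇒image g (boxL B a c ps) (there (here refl)) = c , box∈c B a c ps , refl
  ∈renK⇒image g (boxL B a c ps) (there (there m)) with ∈-++⁻ (paxEdges (renP g ps)) m
  ... | inj₁ p = let (x , mx , e) = ∈pax-ren⇒image g ps p in x , box∈pax B a c ps mx , e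
  ... | inj₂ p = let (x , mx , e) = ∈renL⇒image g B p in x , box∈contents B a c ps mx , e


concl⊆edges : ∀ {L Γ} → Seq L Γ → Γ ⊆ edgesL L
concl⊆edges (s-ax _) (here refl) = here refl
concl⊆edges (s-ax _) (there (here refl)) = there (here refl)
concl⊆edges (s-cut {L₁} {L₂} {a} {b} {Γ} s₁ s₂ _) m with ∈-++⁻ Γ m
... | inj₁ p = ∈-++⁺ʳ (a ∷ b ∷ []) (∈edges-++⁺ˡ L₁ L₂ (concl⊆edges s₁ (there p)))
... | inj₂ p = ∈-++⁺ʳ (a ∷ b ∷ []) (∈edges-++⁺ʳ L₁ L₂ (concl⊆edges s₂ (there p)))
concl⊆edges (s-tens _ _ _ _ _) (here refl) = there (there (here refl))
concl⊆edges (s-tens {L₁} {L₂} {a} {b} {c} {Γ} s₁ s₂ _ _ _) (there m) with ∈-++⁻ Γ m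
... | inj₁ p = ∈-++⁺ʳ (a ∷ b ∷ c ∷ []) (∈edges-++⁺ˡ L₁ L₂ (concl⊆edges s₁ (there p)))
... | inj₂ p = ∈-++⁺ʳ (a ∷ b ∷ c ∷ []) (∈edges-++⁺ʳ L₁ L₂ (concl⊆edges s₂ (there p)))
concl⊆edges (s-par _ _) (here refl) = there (there (here refl))
concl⊆edges (s-par s _) (there m) = there (there (there (concl⊆edges s (there (there m)))))
concl⊆edges (s-all _ _) (here refl) = there (here refl)
concl⊆edges (s-all s _) (there m) = there (there (concl⊆edges s (there m)))
concl⊆edges (s-ex _ _) (here refl) = there (here refl)
concl⊆edges (s-ex s _) (there m) = there (there (concl⊆edges s (there m)))
concl⊆edges (s-para _ _) (here refl) = there (here refl)
concl⊆edges (s-para s _) (there m) = there (there (concl⊆edges s (there m)))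
concl⊆edges (s-flat _ _) (here refl) = there (here refl)
concl⊆edges (s-flat s _) (there m) = there (there (concl⊆edges s (there m)))
concl⊆edges (s-wn _ _) (here refl) = here refl
concl⊆edges (s-wn {es = es} {c} s _) (there m) =
  ∈-++⁺ʳ (c ∷ es) (concl⊆edges s (∈-++⁺ʳ es m))
concl⊆edges (s-box _ _ _ _) (here refl) = there (here refl)
concl⊆edges (s-box {L} {a} {c} {ps} _ _ _ _) (there m) with ∈-map⁻ proj₂ m
... | pq , mpq , refl = ∈-++⁺ˡ (box∈pax L a c ps (pax∈₂ ps mpq))
concl⊆edges (s-exch s p) m = concl⊆edges s (∈-resp-↭ (↭-sym p) m)
concl⊆edges (s-perm s p) m = ∈edges-↭ p (concl⊆edges s m)

paxAtom⊆ : ∀ ps {g} → g ∈ map (λ pq → proj₁ pq ∷ proj₂ pq ∷ []) ps → g ⊆ paxEdges ps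
paxAtom⊆ ((p , q) ∷ ps) (here refl) (here refl) = here refl
paxAtom⊆ ((p , q) ∷ ps) (here refl) (there (here refl)) = there (here refl)
paxAtom⊆ ((p , q) ∷ ps) (there m) mx = there (there (paxAtom⊆ ps m mx))

mutual
  atomsL⊆edges : ∀ L {g} → g ∈ atomsL L → g ⊆ edgesL L
  atomsL⊆edges (l ∷ L) mg mx with ∈-++⁻ (atomsK l) mg
  ... | inj₁ p = ∈-++⁺ˡ (atomsK⊆edges l p mx)
  ... | inj₂ p = ∈-++⁺ʳ (edgesK l) (atomsL⊆edges L p mx)

  atomsK⊆edges : ∀ l {g} → g ∈ atomsK l → g ⊆ edgesK l
  atomsK⊆edges (axL a b) (here refl) mx = mx
  atomsK⊆edges (cutL a b) (here refl) mx = mx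
  atomsK⊆edges (tensL a b c) (here refl) mx = mx
  atomsK⊆edges (parL a b c) (here refl) mx = mx
  atomsK⊆edges (allL a c) (here refl) mx = mx
  atomsK⊆edges (exL a c) (here refl) mx = mx
  atomsK⊆edges (paraL a c) (here refl) mx = mx
  atomsK⊆edges (flatL a c) (here refl) mx = mx
  atomsK⊆edges (wnL es c) (here refl) mx = mx
  atomsK⊆edges (boxL B a c ps) (here refl) (here refl) = here refl
  atomsK⊆edges (boxL B a c ps) (here refl) (there (here refl)) = there (here refl)
  atomsK⊆edges (boxL B a c ps) (there mg) mx
    with ∈-++⁻ (map (λ pq → proj₁ pq ∷ proj₂ pq ∷ []) ps) mg
  ... | inj₁ p = box∈pax B a c ps (paxAtom⊆ ps p mx)
  ... | inj₂ p = box∈contents B a c ps (atomsL⊆edges B p mx)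

-- Index tables.  A step creating fresh copies of old edges indexes every copy like its
-- original; the correspondence is recorded in a table of pairs (copy , original).

Functional : List (ℕ × ℕ) → Set
Functional t = ∀ {k v v'} → (k , v) ∈ t → (k , v') ∈ t → v ≡ v'

update : List (ℕ × ℕ) → (ℕ → ℤ) → ℕ → ℤ
update [] I y = I y
update ((k , v) ∷ t) I y with k ℕ.≟ y
... | yes _ = I v
... | no _ = update t I y

update-miss : ∀ t I y → (∀ {k v} → (k , v) ∈ t → k ≢ y) → update t I y ≡ I y
update-miss [] I y _ = refl
update-miss ((k , v) ∷ t) I y H with k ℕ.≟ y
... | yes k≡y = ⊥-elim (H (here refl) k≡y)
... | no _ = update-miss t I y (H ∘ there)

update-hit : ∀ t I → Functional t → ∀ {k v} → (k , v) ∈ t → update t I k ≡ I v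
update-hit ((k' , v') ∷ t) I F {k} m with k' ℕ.≟ k
... | yes refl = cong I (F (here refl) m)
update-hit ((k' , v') ∷ t) I F (here refl) | no k'≢k = ⊥-elim (k'≢k refl)
update-hit ((k' , v') ∷ t) I F (there m) | no _ = update-hit t I (λ m₁ m₂ → F (there m₁) (there m₂)) m

copyTable : (ℕ → ℕ → ℕ) → List ℕ → ℕ → List ℕ → List (ℕ × ℕ)
copyTable f E j [] = []
copyTable f E j (_ ∷ es) = map (λ x → f j x , x) E ++ copyTable f E (suc j) es

copyTable-key : ∀ f E j es {k v} → (k , v) ∈ copyTable f E j es → ∃ λ j' → k ≡ f j' v
copyTable-key f E j (_ ∷ es) m with ∈-++⁻ (map (λ x → f j x , x) E) m
... | inj₂ m' = copyTable-key f E (suc j) es m'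
... | inj₁ m' with ∈-map⁻ (λ x → f j x , x) m'
...   | x , _ , refl = j , refl

copyTable-∈ : ∀ f E j es i {x} → i < length es → x ∈ E → (f (j ℕ.+ i) x , x) ∈ copyTable f E j es
copyTable-∈ f E j (_ ∷ es) zero _ mx rewrite +-identityʳ j = ∈-++⁺ˡ (∈-map⁺ (λ x → f j x , x) mx)
copyTable-∈ f E j (_ ∷ es) (suc i) (s≤s lt) mx rewrite +-suc j i =
  ∈-++⁺ʳ (map (λ x → f j x , x) E) (copyTable-∈ f E (suc j) es i lt mx)

copyTable-functional : ∀ f → (∀ j x j' x' → f j x ≡ f j' x' → (j ≡ j') × (x ≡ x')) →
  ∀ E j es → Functional (copyTable f E j es)
copyTable-functional f inj E j es m m' with copyTable-key f E j es m | copyTable-key f E j es m'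
... | j₁ , e₁ | j₂ , e₂ = proj₂ (inj j₁ _ j₂ _ (trans (sym e₁) e₂))

-- Box commutation with fresh names rs: each pax link (p , q) of the entering box becomes an
-- inner pax link (p , r) and an outer pax link (r , q).
innerPax : List (ℕ × ℕ) → List ℕ → List (ℕ × ℕ)
innerPax ps rs = zipWith (λ pq r → proj₁ pq , r) ps rs

outerPax : List (ℕ × ℕ) → List ℕ → List (ℕ × ℕ)
outerPax ps rs = zipWith (λ pq r → r , proj₂ pq) ps rs

outerPax⁻ : ∀ ps rs {r q} → (r , q) ∈ outerPax ps rs → r ∈ rs × ∃ λ p → (p , q) ∈ ps
outerPax⁻ ((p , q) ∷ ps) (r ∷ rs) (here refl) = here refl , p , here refl
outerPax⁻ ((p , q) ∷ ps) (r ∷ rs) (there m) with outerPax⁻ ps rs m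
... | mr , p' , mp = there mr , p' , there mp

innerPax⁻ : ∀ ps rs {x r} → (x , r) ∈ innerPax ps rs → ∃ λ q → (x , q) ∈ ps × (r , q) ∈ outerPax ps rs
innerPax⁻ ((p , q) ∷ ps) (r ∷ rs) (here refl) = q , here refl , here refl
innerPax⁻ ((p , q) ∷ ps) (r ∷ rs) (there m) with innerPax⁻ ps rs m
... | q' , m₁ , m₂ = q' , there m₁ , there m₂

outerPax-functional : ∀ ps rs → Unique rs → Functional (outerPax ps rs)
outerPax-functional ((p , q) ∷ ps) (r ∷ rs) u (here refl) (here refl) = refl
outerPax-functional ((p , q) ∷ ps) (r ∷ rs) (r∉ ∷ u) (here refl) (there m) =
  ⊥-elim (All.lookup r∉ (proj₁ (outerPax⁻ ps rs m)) refl)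
outerPax-functional ((p , q) ∷ ps) (r ∷ rs) (r∉ ∷ u) (there m) (here refl) =
  ⊥-elim (All.lookup r∉ (proj₁ (outerPax⁻ ps rs m)) refl)
outerPax-functional ((p , q) ∷ ps) (r ∷ rs) (_ ∷ u) (there m) (there m') = outerPax-functional ps rs u m m'

≡ᵇ-true : ∀ {x y} → (x ≡ᵇ y) ≡ true → x ≡ y
≡ᵇ-true {x} {y} eq = ≡ᵇ⇒≡ x y (subst T (sym eq) tt)

-- Opening a box keeps indices: each pax premise has the index of its conclusion.
paxSubst-index : ∀ {I : ℕ → ℤ} ps → All (λ pq → I (proj₁ pq) ≡ I (proj₂ pq)) ps →
  ∀ x → I (paxSubst ps x) ≡ I x
paxSubst-index [] _ x = refl
paxSubst-index {I} ((p , q) ∷ ps) (e ∷ es) x with x ≡ᵇ p in eq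
... | true = trans (sym e) (cong I (sym (≡ᵇ-true eq)))
... | false = paxSubst-index ps es x

premiseCut⊆ : ∀ cl {a c b d R} → edgesL (cutL a b ∷ R) ⊆ edgesK cl ++ a ∷ c ∷ b ∷ d ∷ edgesL R
premiseCut⊆ cl (here refl) = ∈-++⁺ʳ (edgesK cl) (here refl)
premiseCut⊆ cl (there (here refl)) = ∈-++⁺ʳ (edgesK cl) (there (there (here refl)))
premiseCut⊆ cl (there (there m)) = ∈-++⁺ʳ (edgesK cl) (there (there (there (there m))))

record Transport (U : List ℕ) (L L' : List Link) (I : ℕ → ℤ) : Set where
  field
    index    : ℕ → ℤ
    agrees   : ∀ {x} → x ∈ U → index x ≡ I x
    indexes  : IdxL index L'
    inherits : ∀ {y} → y ∈ edgesL L' → ∃ λ x → x ∈ edgesL L × index y ≡ I x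
open Transport

transport-↭ : ∀ {U L L' lhs rhs I} → L ↭ lhs → L' ↭ rhs → Transport U lhs rhs I → Transport U L L' I
transport-↭ p q tr = record
  { index = index tr
  ; agrees = agrees tr
  ; indexes = IdxL-↭ (↭-sym q) (indexes tr)
  ; inherits = λ m → let (x , mx , e) = inherits tr (∈edges-↭ q m) in x , ∈edges-↭ (↭-sym p) mx , e
  }

module _ {U : List ℕ} {I : ℕ → ℤ} where

  cut≡ : ∀ {cl x y} → IsCut cl x y → IdxK I cl → I x ≡ I y
  cut≡ (inj₁ refl) p = p
  cut≡ (inj₂ refl) p = sym p

  ax≡ : ∀ {al x y} → IsAx al x y → IdxK I al → I x ≡ I y
  ax≡ (inj₁ refl) p = p
  ax≡ (inj₂ refl) p = sym p

  keepIndex : ∀ {L L'} → IdxL I L' → edgesL L' ⊆ edgesL L → Transport U L L' I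
  keepIndex i sub = record
    { index = I ; agrees = λ _ → refl ; indexes = i ; inherits = λ m → _ , sub m , refl }

  -- Axiom step: the cut conclusion c is renamed to the axiom conclusion a, of equal index.
  ruleAx : ∀ {R al cl a b c} → IsAx al a b → IsCut cl b c →
    IdxL I (al ∷ cl ∷ R) → Transport U (al ∷ cl ∷ R) (renL (subst1 c a) R) I
  ruleAx {R} {al} {cl} {a} {b} {c} ax ct (pal , pcl , pR) = record
    { index = I
    ; agrees = λ _ → refl
    ; indexes = renIdxL (subst1 c a) R (λ {x} _ → renamed x) pR
    ; inherits = inh
    }
    where
    renamed : ∀ x → I (subst1 c a x) ≡ I x
    renamed x with x ≡ᵇ c in eq
    ... | true = trans (trans (ax≡ ax pal) (cut≡ ct pcl)) (cong I (sym (≡ᵇ-true eq)))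
    ... | false = refl
    inh : ∀ {y} → y ∈ edgesL (renL (subst1 c a) R) → ∃ λ x → x ∈ edgesL (al ∷ cl ∷ R) × I y ≡ I x
    inh m with ∈renL⇒image (subst1 c a) R m
    ... | x , mx , refl = x , ∈-++⁺ʳ (edgesK al) (∈-++⁺ʳ (edgesK cl) mx) , renamed x

  ruleMult : ∀ {R cl a b c a' b' d} → IsCut cl c d →
    IdxL I (cl ∷ tensL a b c ∷ parL a' b' d ∷ R) →
    Transport U (cl ∷ tensL a b c ∷ parL a' b' d ∷ R) (cutL a a' ∷ cutL b b' ∷ R) I
  ruleMult {R} {cl} {a} {b} {c} {a'} {b'} {d} ct (pcl , (ac , bc) , (a'd , b'd) , pR) =
    keepIndex (trans ac (trans c≡d (sym a'd)) , trans bc (trans c≡d (sym b'd)) , pR)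
              (∈-++⁺ʳ (edgesK cl) ∘ premises⊆)
    where
    c≡d : I c ≡ I d
    c≡d = cut≡ ct pcl
    premises⊆ : a ∷ a' ∷ b ∷ b' ∷ edgesL R ⊆ a ∷ b ∷ c ∷ a' ∷ b' ∷ d ∷ edgesL R
    premises⊆ (here refl) = here refl
    premises⊆ (there (here refl)) = there (there (there (here refl)))
    premises⊆ (there (there (here refl))) = there (here refl)
    premises⊆ (there (there (there (here refl)))) = there (there (there (there (here refl))))
    premises⊆ (there (there (there (there m)))) = there (there (there (there (there (there m)))))

  ruleQuant : ∀ {R cl a b c d} → IsCut cl c d → IdxL I (cl ∷ allL a c ∷ exL b d ∷ R) →
    Transport U (cl ∷ allL a c ∷ exL b d ∷ R) (cutL a b ∷ R) I
  ruleQuant {R} {cl} ct (pcl , ac , bd , pR) =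
    keepIndex (trans ac (trans (cut≡ ct pcl) (sym bd)) , pR) (premiseCut⊆ cl {R = R})

  -- Paragraph/paragraph step: both premises sit one level above the cut.
  rulePara : ∀ {R cl a b c d} → IsCut cl c d → IdxL I (cl ∷ paraL a c ∷ paraL b d ∷ R) →
    Transport U (cl ∷ paraL a c ∷ paraL b d ∷ R) (cutL a b ∷ R) I
  rulePara {R} {cl} ct (pcl , ac , bd , pR) =
    keepIndex (trans ac (trans (cong (_+ 1ℤ) (cut≡ ct pcl)) (sym bd)) , pR) (premiseCut⊆ cl {R = R})

  ruleFlat : ∀ {R cl B a c ps g d} → IsCut cl c d →
    IdxL I (cl ∷ boxL B a c ps ∷ flatL g d ∷ R) →
    Transport U (cl ∷ boxL B a c ps ∷ flatL g d ∷ R) (cutL a g ∷ renL (paxSubst ps) B ++ R) I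
  ruleFlat {R} {cl} {B} {a} {c} {ps} {g} {d} ct (pcl , (ac , pps , pB) , gd , pR) = record
    { index = I
    ; agrees = λ _ → refl
    ; indexes = trans ac (trans (cong (_+ 1ℤ) (cut≡ ct pcl)) (sym gd)) ,
                IdxL-++ (renL (paxSubst ps) B) R
                  (renIdxL (paxSubst ps) B (λ {x} _ → paxSubst-index ps pps x) pB) pR
    ; inherits = inh
    }
    where
    Bx = boxL B a c ps
    old : edgesL (Bx ∷ flatL g d ∷ R) ⊆ edgesL (cl ∷ Bx ∷ flatL g d ∷ R)
    old = ∈-++⁺ʳ (edgesK cl)
    inh : ∀ {y} → y ∈ edgesL (cutL a g ∷ renL (paxSubst ps) B ++ R) →
      ∃ λ x → x ∈ edgesL (cl ∷ Bx ∷ flatL g d ∷ R) × I y ≡ I x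
    inh (here refl) = a , old (∈-++⁺ˡ (box∈a B a c ps)) , refl
    inh (there (here refl)) = g , old (∈-++⁺ʳ (edgesK Bx) (here refl)) , refl
    inh (there (there m)) with ∈edges-++⁻ (renL (paxSubst ps) B) R m
    ... | inj₂ mR = _ , old (∈-++⁺ʳ (edgesK Bx) (there (there mR))) , refl
    ... | inj₁ mB with ∈renL⇒image (paxSubst ps) B mB
    ...   | x , mx , refl = x , old (∈-++⁺ˡ (box∈contents B a c ps mx)) , paxSubst-index ps pps x

  -- Duplication: one copy of the box per premise of the why-not link, copy j named by f j;
  -- every copy of an edge x takes the index of x.
  ruleDup : ∀ {R cl B a c ps es d} → IsCut cl c d → (f : ℕ → ℕ → ℕ) →
    (∀ j x j' x' → f j x ≡ f j' x' → (j ≡ j') × (x ≡ x')) → (∀ j x → f j x ∉ U) →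
    edgesL (cl ∷ boxL B a c ps ∷ wnL es d ∷ R) ⊆ U →
    IdxL I (cl ∷ boxL B a c ps ∷ wnL es d ∷ R) →
    Transport U (cl ∷ boxL B a c ps ∷ wnL es d ∷ R)
                (copies f B a c ps 0 es ++ contractions f ps (length es) ++ R) I
  ruleDup {R} {cl} {B} {a} {c} {ps} {es} {d} ct f inj fresh used (pcl , pBx , pW , pR) = record
    { index = J
    ; agrees = agree
    ; indexes = IdxL-++ Cp (Cn ++ R) (copiesIdx 0 es (λ m → m) (λ m → m) pW)
                  (IdxL-++ Cn R (contractionsIdx ps paxConcl) (reindexL R (agree ∘ used ∘ RL) pR))
    ; inherits = inh
    }
    where
    Bx = boxL B a c ps
    Eb = edgesK Bx
    K = length es
    Cp = copies f B a c ps 0 es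
    Cn = contractions f ps K
    lhs = cl ∷ Bx ∷ wnL es d ∷ R
    t = copyTable f Eb 0 es
    J = update t I

    EbL : Eb ⊆ edgesL lhs
    EbL = ∈-++⁺ʳ (edgesK cl) ∘ ∈-++⁺ˡ
    esL : es ⊆ edgesL lhs
    esL = ∈-++⁺ʳ (edgesK cl) ∘ ∈-++⁺ʳ Eb ∘ there ∘ ∈-++⁺ˡ
    RL : edgesL R ⊆ edgesL lhs
    RL = ∈-++⁺ʳ (edgesK cl) ∘ ∈-++⁺ʳ Eb ∘ there ∘ ∈-++⁺ʳ es
    paxConcl : ∀ {p q} → (p , q) ∈ ps → q ∈ Eb
    paxConcl = box∈pax B a c ps ∘ pax∈₂ ps

    -- the copies are fresh, so J agrees with I on used names
    agree : ∀ {y} → y ∈ U → J y ≡ I y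
    agree {y} my = update-miss t I y λ m e →
      let (j , k≡fjv) = copyTable-key f Eb 0 es m in fresh j _ (subst (_∈ U) (trans (sym e) k≡fjv) my)
    copied : ∀ {j x} → (f j x , x) ∈ t → J (f j x) ≡ I x
    copied = update-hit t I (copyTable-functional f inj Eb 0 es)
    copyOfPax : ∀ {j q} → j ∈ upTo K → q ∈ Eb → J (f j q) ≡ I q
    copyOfPax mj mq with ∈-applyUpTo⁻ (λ z → z) mj
    ... | i , lt , refl = copied (copyTable-∈ f Eb 0 es i lt mq)

    inCopy : ∀ j {x} → x ∈ Eb → (f j x , x) ∈ map (λ x → f j x , x) Eb
    inCopy j = ∈-map⁺ (λ x → f j x , x)

    copiesIdx : ∀ j es' → copyTable f Eb j es' ⊆ t → es' ⊆ es → All (λ e → I e ≡ I d) es' →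
      IdxL J (copies f B a c ps j es')
    copiesIdx j [] _ _ _ = tt
    copiesIdx j (e ∷ es') sub ⊆es (ed ∷ eds) =
      renIdxK (f j) Bx (copied ∘ sub ∘ ∈-++⁺ˡ ∘ inCopy j) pBx ,
      trans (copied (sub (∈-++⁺ˡ (inCopy j (box∈c B a c ps)))))
            (trans (cut≡ ct pcl) (trans (sym ed) (sym (agree (used (esL (⊆es (here refl)))))))) ,
      copiesIdx (suc j) es' (sub ∘ ∈-++⁺ʳ (map (λ x → f j x , x) Eb)) (⊆es ∘ there) eds

    contractionsIdx : ∀ qs → (∀ {p q} → (p , q) ∈ qs → q ∈ Eb) → IdxL J (contractions f qs K)
    contractionsIdx [] _ = tt
    contractionsIdx ((p , q) ∷ qs) H =
      AllP.map⁺ (All.tabulate λ mj → trans (copyOfPax mj (H (here refl))) (sym (agree (used (EbL (H (here refl))))))) ,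
      contractionsIdx qs (H ∘ there)

    Inherited : ℕ → Set
    Inherited y = ∃ λ x → x ∈ edgesL lhs × J y ≡ I x
    old : ∀ {y} → y ∈ edgesL lhs → Inherited y
    old m = _ , m , agree (used m)

    copiesInh : ∀ j es' → copyTable f Eb j es' ⊆ t → es' ⊆ es →
      ∀ {y} → y ∈ edgesL (copies f B a c ps j es') → Inherited y
    copiesInh j (e ∷ es') sub ⊆es m with ∈-++⁻ (edgesK (renK (f j) Bx)) m
    ... | inj₁ m' with ∈renK⇒image (f j) Bx m'
    ...   | x , mx , refl = x , EbL mx , copied (sub (∈-++⁺ˡ (inCopy j mx)))
    copiesInh j (e ∷ es') sub ⊆es m | inj₂ (here refl) =
      c , EbL (box∈c B a c ps) , copied (sub (∈-++⁺ˡ (inCopy j (box∈c B a c ps))))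
    copiesInh j (e ∷ es') sub ⊆es m | inj₂ (there (here refl)) = old (esL (⊆es (here refl)))
    copiesInh j (e ∷ es') sub ⊆es m | inj₂ (there (there m')) =
      copiesInh (suc j) es' (sub ∘ ∈-++⁺ʳ (map (λ x → f j x , x) Eb)) (⊆es ∘ there) m'

    contractionsInh : ∀ qs → (∀ {p q} → (p , q) ∈ qs → q ∈ Eb) →
      ∀ {y} → y ∈ edgesL (contractions f qs K) → Inherited y
    contractionsInh ((p , q) ∷ qs) H (here refl) = old (EbL (H (here refl)))
    contractionsInh ((p , q) ∷ qs) H (there m) with ∈-++⁻ (map (λ j → f j q) (upTo K)) m
    ... | inj₂ m' = contractionsInh qs (H ∘ there) m'
    ... | inj₁ m' with ∈-map⁻ (λ j → f j q) m'
    ...   | j , mj , refl = q , EbL (H (here refl)) , copyOfPax mj (H (here refl))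

    inh : ∀ {y} → y ∈ edgesL (Cp ++ Cn ++ R) → Inherited y
    inh m with ∈edges-++⁻ Cp (Cn ++ R) m
    ... | inj₁ mC = copiesInh 0 es (λ m → m) (λ m → m) mC
    ... | inj₂ m' with ∈edges-++⁻ Cn R m'
    ...   | inj₁ mC = contractionsInh ps paxConcl mC
    ...   | inj₂ mR = old (RL mR)

  -- Commutation: the box Bx enters the box B2x through its auxiliary door (p , d); each
  -- fresh door r, outer copy of a pax conclusion q of Bx, takes the index of q.
  ruleComm : ∀ {R cl B a c ps B₂ a₂ c₂ ps₂ qs₂ p d rs} → IsCut cl c d →
    ps₂ ↭ (p , d) ∷ qs₂ → Unique rs → All (_∉ U) rs →
    edgesL (cl ∷ boxL B a c ps ∷ boxL B₂ a₂ c₂ ps₂ ∷ R) ⊆ U →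
    IdxL I (cl ∷ boxL B a c ps ∷ boxL B₂ a₂ c₂ ps₂ ∷ R) →
    Transport U (cl ∷ boxL B a c ps ∷ boxL B₂ a₂ c₂ ps₂ ∷ R)
      (boxL (cutL c p ∷ boxL B a c (innerPax ps rs) ∷ B₂) a₂ c₂ (outerPax ps rs ++ qs₂) ∷ R) I
  ruleComm {R} {cl} {B} {a} {c} {ps} {B₂} {a₂} {c₂} {ps₂} {qs₂} {p} {d} {rs}
    ct perm distinct fresh used (pcl , pBx , pB2x , pR) = record
    { index = J
    ; agrees = agree
    ; indexes = outerIdx , reindexL R (agree ∘ used ∘ RL) pR
    ; inherits = inh
    }
    where
    Bx = boxL B a c ps
    B2x = boxL B₂ a₂ c₂ ps₂
    lhs = cl ∷ Bx ∷ B2x ∷ R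
    Z = outerPax ps rs
    In = innerPax ps rs
    Inner = boxL B a c In
    Contents = cutL c p ∷ Inner ∷ B₂
    Outer = boxL Contents a₂ c₂ (Z ++ qs₂)
    J = update Z I

    B1L : edgesK Bx ⊆ edgesL lhs
    B1L = ∈-++⁺ʳ (edgesK cl) ∘ ∈-++⁺ˡ
    B2L : edgesK B2x ⊆ edgesL lhs
    B2L = ∈-++⁺ʳ (edgesK cl) ∘ ∈-++⁺ʳ (edgesK Bx) ∘ ∈-++⁺ˡ
    RL : edgesL R ⊆ edgesL lhs
    RL = ∈-++⁺ʳ (edgesK cl) ∘ ∈-++⁺ʳ (edgesK Bx) ∘ ∈-++⁺ʳ (edgesK B2x)
    pd∈ : (p , d) ∈ ps₂
    pd∈ = ∈-resp-↭ (↭-sym perm) (here refl)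
    qs⊆ : qs₂ ⊆ ps₂
    qs⊆ = ∈-resp-↭ (↭-sym perm) ∘ there
    doorOf : ∀ {r q} → (r , q) ∈ Z → q ∈ edgesK Bx
    doorOf m = let (_ , _ , mpq) = outerPax⁻ ps rs m in box∈pax B a c ps (pax∈₂ ps mpq)

    -- the new doors are fresh, so J agrees with I on used names
    agree : ∀ {y} → y ∈ U → J y ≡ I y
    agree {y} my = update-miss Z I y λ m e →
      All.lookup fresh (proj₁ (outerPax⁻ ps rs m)) (subst (_∈ U) (sym e) my)
    door : ∀ {r q} → (r , q) ∈ Z → J r ≡ I q
    door = update-hit Z I (outerPax-functional ps rs distinct)

    pBx' : IdxK J Bx
    pBx' = reindexK Bx (agree ∘ used ∘ B1L) pBx
    pB2x' : IdxK J B2x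
    pB2x' = reindexK B2x (agree ∘ used ∘ B2L) pB2x
    pax₂ : All (λ pq → J (proj₁ pq) ≡ J (proj₂ pq)) ((p , d) ∷ qs₂)
    pax₂ = All-resp-↭ perm (proj₁ (proj₂ pB2x'))

    cutIdx : J c ≡ J p
    cutIdx = trans (agree (used (B1L (box∈c B a c ps)))) (trans (cut≡ ct pcl)
      (trans (sym (agree (used (B2L (box∈pax B₂ a₂ c₂ ps₂ (pax∈₂ ps₂ pd∈)))))) (sym (All.head pax₂))))
    outerDoorsIdx : All (λ pq → J (proj₁ pq) ≡ J (proj₂ pq)) Z
    outerDoorsIdx = All.tabulate λ m → trans (door m) (sym (agree (used (B1L (doorOf m)))))
    innerDoorsIdx : All (λ pq → J (proj₁ pq) ≡ J (proj₂ pq)) In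
    innerDoorsIdx = All.tabulate λ m → let (q , m₁ , m₂) = innerPax⁻ ps rs m in
      trans (agree (used (B1L (box∈pax B a c ps (pax∈₁ ps m₁)))))
            (trans (All.lookup (proj₁ (proj₂ pBx)) m₁) (sym (door m₂)))
    outerIdx : IdxK J Outer
    outerIdx = proj₁ pB2x' , AllP.++⁺ outerDoorsIdx (All.tail pax₂) ,
      cutIdx , (proj₁ pBx' , innerDoorsIdx , proj₂ (proj₂ pBx')) , proj₂ (proj₂ pB2x')

    Inherited : ℕ → Set
    Inherited y = ∃ λ x → x ∈ edgesL lhs × J y ≡ I x
    old : ∀ {y} → y ∈ edgesL lhs → Inherited y
    old m = _ , m , agree (used m)
    newDoor : ∀ {r q} → (r , q) ∈ Z → Inherited r
    newDoor m = _ , B1L (doorOf m) , door m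

    contentsInh : ∀ {y} → y ∈ edgesL Contents → Inherited y
    contentsInh (here refl) = old (B1L (box∈c B a c ps))
    contentsInh (there (here refl)) = old (B2L (box∈pax B₂ a₂ c₂ ps₂ (pax∈₁ ps₂ pd∈)))
    contentsInh (there (there m)) with ∈-++⁻ (edgesK Inner) m
    ... | inj₂ m' = old (B2L (box∈contents B₂ a₂ c₂ ps₂ m'))
    ... | inj₁ (here refl) = old (B1L (box∈a B a c ps))
    ... | inj₁ (there (here refl)) = old (B1L (box∈c B a c ps))
    ... | inj₁ (there (there m')) with ∈-++⁻ (paxEdges In) m'
    ...   | inj₂ mB = old (B1L (box∈contents B a c ps mB))
    ...   | inj₁ mp with pax∈⁻ In mp
    ...     | _ , mxr , inj₁ refl = let (_ , m₁ , _) = innerPax⁻ ps rs mxr in old (B1L (box∈pax B a c ps (pax∈₁ ps m₁)))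
    ...     | _ , mxr , inj₂ refl = let (_ , _ , m₂) = innerPax⁻ ps rs mxr in newDoor m₂

    inh : ∀ {y} → y ∈ edgesL (Outer ∷ R) → Inherited y
    inh m with ∈-++⁻ (edgesK Outer) m
    ... | inj₂ m' = old (RL m')
    ... | inj₁ (here refl) = old (B2L (box∈a B₂ a₂ c₂ ps₂))
    ... | inj₁ (there (here refl)) = old (B2L (box∈c B₂ a₂ c₂ ps₂))
    ... | inj₁ (there (there m')) with ∈-++⁻ (paxEdges (Z ++ qs₂)) m'
    ...   | inj₂ mB = contentsInh mB
    ...   | inj₁ mp with pax∈⁻ (Z ++ qs₂) mp
    ...     | _ , mxz , side with ∈-++⁻ Z mxz | side
    ...       | inj₁ mZ | inj₁ refl = newDoor mZ
    ...       | inj₁ mZ | inj₂ refl = old (B1L (doorOf mZ))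
    ...       | inj₂ mQ | inj₁ refl = old (B2L (box∈pax B₂ a₂ c₂ ps₂ (pax∈₁ ps₂ (qs⊆ mQ))))
    ...       | inj₂ mQ | inj₂ refl = old (B2L (box∈pax B₂ a₂ c₂ ps₂ (pax∈₂ ps₂ (qs⊆ mQ))))

  ruleInbox : ∀ {R B B' a c ps} → (IdxL I B → Transport U B B' I) →
    edgesL (boxL B a c ps ∷ R) ⊆ U → IdxL I (boxL B a c ps ∷ R) →
    Transport U (boxL B a c ps ∷ R) (boxL B' a c ps ∷ R) I
  ruleInbox {R} {B} {B'} {a} {c} {ps} inner used (pBx , pR) = record
    { index = J
    ; agrees = agree
    ; indexes = (proj₁ pBx' , proj₁ (proj₂ pBx') , indexes trB) , reindexL R (agree ∘ used ∘ RL) pR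
    ; inherits = inh
    }
    where
    Bx = boxL B a c ps
    trB = inner (proj₂ (proj₂ pBx))
    J = index trB
    agree : ∀ {y} → y ∈ U → J y ≡ I y
    agree = agrees trB
    RL : edgesL R ⊆ edgesL (Bx ∷ R)
    RL = ∈-++⁺ʳ (edgesK Bx)
    pBx' : IdxK J Bx
    pBx' = reindexK Bx (agree ∘ used ∘ ∈-++⁺ˡ) pBx
    Inherited : ℕ → Set
    Inherited y = ∃ λ x → x ∈ edgesL (Bx ∷ R) × J y ≡ I x
    old : ∀ {y} → y ∈ edgesL (Bx ∷ R) → Inherited y
    old m = _ , m , agree (used m)
    inh : ∀ {y} → y ∈ edgesL (boxL B' a c ps ∷ R) → Inherited y
    inh m with ∈-++⁻ (edgesK (boxL B' a c ps)) m
    ... | inj₂ m' = old (RL m')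
    ... | inj₁ (here refl) = old (∈-++⁺ˡ (box∈a B a c ps))
    ... | inj₁ (there (here refl)) = old (∈-++⁺ˡ (box∈c B a c ps))
    ... | inj₁ (there (there m')) with ∈-++⁻ (paxEdges ps) m'
    ...   | inj₁ mp = old (∈-++⁺ˡ (box∈pax B a c ps mp))
    ...   | inj₂ mB = let (x , mx , e) = inherits trB mB in x , ∈-++⁺ˡ (box∈contents B a c ps mx) , e

transport : ∀ {U L L' I} → Step U L L' → edgesL L ⊆ U → IdxL I L → Transport U L L' I
transport (base (r-ax ax ct p q)) used i = transport-↭ p q (ruleAx ax ct (IdxL-↭ p i))
transport (base (r-mult ct p q)) used i = transport-↭ p q (ruleMult ct (IdxL-↭ p i))
transport (base (r-quant ct p q)) used i = transport-↭ p q (ruleQuant ct (IdxL-↭ p i))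
transport (base (r-para ct p q)) used i = transport-↭ p q (rulePara ct (IdxL-↭ p i))
transport (base (r-flat ct p q)) used i = transport-↭ p q (ruleFlat ct (IdxL-↭ p i))
transport (base (r-dup ct p f inj fresh q)) used i =
  transport-↭ p q (ruleDup ct f inj fresh (used ∘ ∈edges-↭ (↭-sym p)) (IdxL-↭ p i))
transport (base (r-comm ct p perm _ distinct fresh q)) used i =
  transport-↭ p q (ruleComm ct perm distinct fresh (used ∘ ∈edges-↭ (↭-sym p)) (IdxL-↭ p i))
transport {U} (inbox {R = R} {B} {a = a} {c} {ps} p st q) used i =
  transport-↭ p q (ruleInbox (transport st (boxUsed ∘ ∈-++⁺ˡ ∘ box∈contents B a c ps)) boxUsed (IdxL-↭ p i))
  where
  boxUsed : edgesL (boxL B a c ps ∷ R) ⊆ U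
  boxUsed = used ∘ ∈edges-↭ (↭-sym p)

-- Reachability for a decidable relation on ℕ whose targets lie in a given finite list is
-- decidable: a path need only pass through the listed vertices.
module Reachability (A : ℕ → ℕ → Set) (A? : ∀ x y → Dec (A x y)) where

  data Path (V : List ℕ) : ℕ → ℕ → Set where
    edge : ∀ {x y} → A x y → Path V x y
    via  : ∀ {x z y} → A x z → z ∈ V → Path V z y → Path V x y

  path-weaken : ∀ {v V x y} → Path V x y → Path (v ∷ V) x y
  path-weaken (edge s) = edge s
  path-weaken (via s m p) = via s (there m) (path-weaken p)

  path-++ : ∀ {V x v y} → Path V x v → v ∈ V → Path V v y → Path V x y
  path-++ (edge s) m q = via s m q
  path-++ (via s m' p) m q = via s m' (path-++ p m q)

  path-split : ∀ {v V x y} → Path (v ∷ V) x y → Path V x y ⊎ (Path V x v × Path V v y)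
  path-split (edge s) = inj₁ (edge s)
  path-split (via s (here refl) p) with path-split p
  ... | inj₁ q = inj₂ (edge s , q)
  ... | inj₂ (_ , q) = inj₂ (edge s , q)
  path-split (via s (there m) p) with path-split p
  ... | inj₁ q = inj₁ (via s m q)
  ... | inj₂ (q₁ , q₂) = inj₂ (via s m q₁ , q₂)

  path? : ∀ V x y → Dec (Path V x y)
  path? [] x y with A? x y
  ... | yes s = yes (edge s)
  ... | no ¬s = no λ { (edge s) → ¬s s ; (via _ () _) }
  path? (v ∷ V) x y with path? V x y | path? V x v | path? V v y
  ... | yes p | _ | _ = yes (path-weaken p)
  ... | no _ | yes p | yes q = yes (path-++ (path-weaken p) (here refl) (path-weaken q))
  ... | no ¬p | no ¬q | _ = no λ r → [ ¬p , ¬q ∘ proj₁ ]′ (path-split r)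
  ... | no ¬p | yes _ | no ¬q = no λ r → [ ¬p , ¬q ∘ proj₂ ]′ (path-split r)

  path⇒star : ∀ {V x y} → Path V x y → Star A x y
  path⇒star (edge s) = s ◅ ε
  path⇒star (via s _ p) = s ◅ path⇒star p

  module _ (E : List ℕ) (target∈ : ∀ {x y} → A x y → y ∈ E) where

    star⇒path : ∀ {x y} → Star A x y → x ≡ y ⊎ Path E x y
    star⇒path ε = inj₁ refl
    star⇒path (s ◅ ss) with star⇒path ss
    ... | inj₁ refl = inj₂ (edge s)
    ... | inj₂ p = inj₂ (via s (target∈ s) p)

    reachable? : ∀ x y → Dec (Star A x y)
    reachable? x y with x ℕ.≟ y | path? E x y
    ... | yes refl | _ = yes ε
    ... | no _ | yes p = yes (path⇒star p)
    ... | no x≢y | no ¬p = no λ ss → [ x≢y , ¬p ]′ (star⇒path ss)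

-- Shifting an indexing: subtracting from J a function M that is constant on every atom
-- preserves the indexing constraints, which only compare edges of a common atom.
module Shift (J M : ℕ → ℤ) where

  shifted : ℕ → ℤ
  shifted x = J x - M x

  ConstOn : List (List ℕ) → Set
  ConstOn G = ∀ {g} → g ∈ G → ∀ {x y} → x ∈ g → y ∈ g → M x ≡ M y

  shift-≡ : ∀ {x y} → J x ≡ J y → M x ≡ M y → shifted x ≡ shifted y
  shift-≡ = cong₂ _-_

  shift-+1 : ∀ {x y} → J x ≡ J y + 1ℤ → M x ≡ M y → shifted x ≡ shifted y + 1ℤ
  shift-+1 {x} {y} e e' = trans (cong₂ _-_ e e') (+1-minus (J y) (M y))
    where
    +1-minus : ∀ i j → (i + 1ℤ) - j ≡ (i - j) + 1ℤ
    +1-minus = solve-∀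

  shift-pax : ∀ ps → ConstOn (map (λ pq → proj₁ pq ∷ proj₂ pq ∷ []) ps) →
    All (λ pq → J (proj₁ pq) ≡ J (proj₂ pq)) ps → All (λ pq → shifted (proj₁ pq) ≡ shifted (proj₂ pq)) ps
  shift-pax [] H [] = []
  shift-pax ((p , q) ∷ ps) H (e ∷ es) =
    shift-≡ e (H (here refl) (here refl) (there (here refl))) ∷ shift-pax ps (H ∘ there) es

  shift-wn : ∀ c es → (∀ {x y} → x ∈ c ∷ es → y ∈ c ∷ es → M x ≡ M y) →
    All (λ e → J e ≡ J c) es → All (λ e → shifted e ≡ shifted c) es
  shift-wn c [] H [] = []
  shift-wn c (e ∷ es) H (p ∷ ps) =
    shift-≡ p (H (there (here refl)) (here refl)) ∷ shift-wn c es (λ mx my → H (skip mx) (skip my)) ps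
    where
    skip : ∀ {z} → z ∈ c ∷ es → z ∈ c ∷ e ∷ es
    skip (here q) = here q
    skip (there m) = there (there m)

  mutual
    shiftL : ∀ L → ConstOn (atomsL L) → IdxL J L → IdxL shifted L
    shiftL [] H _ = tt
    shiftL (l ∷ L) H (p , q) = shiftK l (H ∘ ∈-++⁺ˡ) p , shiftL L (H ∘ ∈-++⁺ʳ (atomsK l)) q

    shiftK : ∀ l → ConstOn (atomsK l) → IdxK J l → IdxK shifted l
    shiftK (axL a b) H p = shift-≡ p (H (here refl) (here refl) (there (here refl)))
    shiftK (cutL a b) H p = shift-≡ p (H (here refl) (here refl) (there (here refl)))
    shiftK (tensL a b c) H (p , q) =
      shift-≡ p (H (here refl) (here refl) (there (there (here refl)))) ,
      shift-≡ q (H (here refl) (there (here refl)) (there (there (here refl))))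
    shiftK (parL a b c) H (p , q) =
      shift-≡ p (H (here refl) (here refl) (there (there (here refl)))) ,
      shift-≡ q (H (here refl) (there (here refl)) (there (there (here refl))))
    shiftK (allL a c) H p = shift-≡ p (H (here refl) (here refl) (there (here refl)))
    shiftK (exL a c) H p = shift-≡ p (H (here refl) (here refl) (there (here refl)))
    shiftK (paraL a c) H p = shift-+1 p (H (here refl) (here refl) (there (here refl)))
    shiftK (flatL a c) H p = shift-+1 p (H (here refl) (here refl) (there (here refl)))
    shiftK (wnL es c) H p = shift-wn c es (H (here refl)) p
    shiftK (boxL B a c ps) H (p , q , r) =
      shift-+1 p (H (here refl) (here refl) (there (here refl))) ,
      shift-pax ps (H ∘ there ∘ ∈-++⁺ˡ) q ,
      shiftL B (H ∘ there ∘ ∈-++⁺ʳ (map (λ pq → proj₁ pq ∷ proj₂ pq ∷ []) ps)) r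

sharedAtom? : ∀ (G : List (List ℕ)) x y → Dec (∃ λ g → g ∈ G × x ∈ g × y ∈ g)
sharedAtom? [] x y = no λ { (g , () , _) }
sharedAtom? (g ∷ G) x y with x ∈? g | y ∈? g | sharedAtom? G x y
... | yes p | yes q | _ = yes (g , here refl , p , q)
... | _ | _ | yes (h , m , p , q) = yes (h , there m , p , q)
... | no ¬p | _ | no ¬r = no λ { (h , here refl , p , q) → ¬p p ; (h , there m , p , q) → ¬r (h , m , p , q) }
... | yes _ | no ¬q | no ¬r = no λ { (h , here refl , p , q) → ¬q q ; (h , there m , p , q) → ¬r (h , m , p , q) }

adjacent? : ∀ π x y → Dec (Adj π x y)
adjacent? π x y with sharedAtom? (atomsL (links π)) x y | x ∈? concl π | y ∈? concl π
... | yes p | _ | _ = yes (inj₁ p)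
... | no _ | yes p | yes q = yes (inj₂ (p , q))
... | no ¬p | no ¬x | _ = no λ { (inj₁ p) → ¬p p ; (inj₂ (p , _)) → ¬x p }
... | no ¬p | yes _ | no ¬y = no λ { (inj₁ p) → ¬p p ; (inj₂ (_ , q)) → ¬y q }

adjacent⊆edges : ∀ π {x y} → Adj π x y → x ∈ edges π × y ∈ edges π
adjacent⊆edges π (inj₁ (g , mg , mx , my)) = atomsL⊆edges (links π) mg mx , atomsL⊆edges (links π) mg my
adjacent⊆edges π (inj₂ (mx , my)) = concl⊆edges (seq π) mx , concl⊆edges (seq π) my

adjacent-sym : ∀ π {x y} → Adj π x y → Adj π y x
adjacent-sym π (inj₁ (g , mg , mx , my)) = inj₁ (g , mg , my , mx)
adjacent-sym π (inj₂ (mx , my)) = inj₂ (my , mx)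

module Normalisation (π : Net) (J : ℕ → ℤ) (idx : Indexing π J)
                     (J≥0 : ∀ x → x ∈ edges π → 0ℤ ≤ J x) where

  E : List ℕ
  E = edges π

  open Reachability (Adj π) (adjacent? π)

  connected? : ∀ x y → Dec (Connected π x y)
  connected? = reachable? E (λ s → proj₂ (adjacent⊆edges π s))

  connected∈ : ∀ {x y} → x ∈ E → Connected π x y → y ∈ E
  connected∈ mx ε = mx
  connected∈ mx (s ◅ ss) = connected∈ (proj₂ (adjacent⊆edges π s)) ss

  componentMin : ℕ → List ℕ → ℤ
  componentMin x [] = J x
  componentMin x (y ∷ ys) with connected? x y
  ... | yes _ = J y ⊓ componentMin x ys
  ... | no _ = componentMin x ys

  componentMin≤self : ∀ x ys → componentMin x ys ≤ J x
  componentMin≤self x [] = ℤP.≤-refl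
  componentMin≤self x (y ∷ ys) with connected? x y
  ... | yes _ = ℤP.≤-trans (ℤP.i⊓j≤j (J y) _) (componentMin≤self x ys)
  ... | no _ = componentMin≤self x ys

  componentMin≤ : ∀ x ys {y} → y ∈ ys → Connected π x y → componentMin x ys ≤ J y
  componentMin≤ x (z ∷ ys) m s with connected? x z
  componentMin≤ x (z ∷ ys) (here refl) s | yes _ = ℤP.i⊓j≤i (J z) _
  componentMin≤ x (z ∷ ys) (there m) s | yes _ = ℤP.≤-trans (ℤP.i⊓j≤j (J z) _) (componentMin≤ x ys m s)
  componentMin≤ x (z ∷ ys) (here refl) s | no ¬s = ⊥-elim (¬s s)
  componentMin≤ x (z ∷ ys) (there m) s | no _ = componentMin≤ x ys m s

  componentMin-attained : ∀ x ys →
    componentMin x ys ≡ J x ⊎ ∃ λ y → y ∈ ys × Connected π x y × componentMin x ys ≡ J y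
  componentMin-attained x [] = inj₁ refl
  componentMin-attained x (z ∷ ys) with connected? x z
  ... | no _ = Sum.map (λ e → e) (λ { (y , m , s , e) → y , there m , s , e }) (componentMin-attained x ys)
  ... | yes s with ℤP.⊓-sel (J z) (componentMin x ys)
  ...   | inj₁ e = inj₂ (z , here refl , s , e)
  ...   | inj₂ e with componentMin-attained x ys
  ...     | inj₁ e' = inj₁ (trans e e')
  ...     | inj₂ (y , m , s' , e') = inj₂ (y , there m , s' , trans e e')

  M : ℕ → ℤ
  M x = componentMin x E

  M-attained : ∀ x → x ∈ E → ∃ λ z → z ∈ E × Connected π x z × M x ≡ J z
  M-attained x mx with componentMin-attained x E
  ... | inj₁ e = x , mx , ε , e
  ... | inj₂ w = w

  M-mono : ∀ {x y} → x ∈ E → Connected π x y → M x ≤ M y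
  M-mono {x} {y} mx s with M-attained y (connected∈ mx s)
  ... | z , mz , s' , e = ℤP.≤-trans (componentMin≤ x E mz (s ◅◅ s')) (ℤP.≤-reflexive (sym e))

  M-const : ∀ {x y} → x ∈ E → Connected π x y → M x ≡ M y
  M-const mx s = ℤP.≤-antisym (M-mono mx s) (M-mono (connected∈ mx s) (reverse (adjacent-sym π) s))

  M≥0 : ∀ x → x ∈ E → 0ℤ ≤ M x
  M≥0 x mx with M-attained x mx
  ... | z , mz , _ , e = ℤP.≤-trans (J≥0 z mz) (ℤP.≤-reflexive (sym e))

  open Shift J M

  canonical : Canonical π shifted
  canonical = (shiftL (links π) sameAtom (proj₁ idx) , conclusions) , nonnegative , vanishing
    where
    sameAtom : ConstOn (atomsL (links π))
    sameAtom mg mx my = M-const (atomsL⊆edges (links π) mg mx) (inj₁ (_ , mg , mx , my) ◅ ε)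
    conclusions : ∀ x y → x ∈ concl π → y ∈ concl π → shifted x ≡ shifted y
    conclusions x y mx my = shift-≡ (proj₂ idx x y mx my) (M-const (concl⊆edges (seq π) mx) (inj₂ (mx , my) ◅ ε))
    nonnegative : ∀ x → x ∈ E → 0ℤ ≤ shifted x
    nonnegative x mx = ℤP.i≤j⇒0≤j-i (componentMin≤self x E)
    vanishing : ∀ x → x ∈ E → ∃ λ y → y ∈ E × Connected π x y × shifted y ≡ 0ℤ
    vanishing x mx with M-attained x mx
    ... | z , mz , s , e =
      z , mz , s , trans (cong (λ t → J z - t) (trans (sym (M-const mx s)) e)) (ℤP.+-inverseʳ (J z))

  shifted≤J : ∀ x → x ∈ E → shifted x ≤ J x
  shifted≤J x mx =
    ℤP.≤-trans (ℤP.+-monoʳ-≤ (J x) (ℤP.neg-mono-≤ (M≥0 x mx))) (ℤP.≤-reflexive (ℤP.+-identityʳ (J x)))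

normalise : ∀ π J → Indexing π J → (∀ x → x ∈ edges π → 0ℤ ≤ J x) →
  ∃ λ I' → Canonical π I' × (∀ x → x ∈ edges π → I' x ≤ J x)
normalise π J idx J≥0 = shifted , canonical , shifted≤J
  where open Normalisation π J idx J≥0
        open Shift J M

max≥0 : ∀ (xs : List ℤ) → 0ℤ ≤ foldr _⊔_ 0ℤ xs
max≥0 [] = ℤP.≤-refl
max≥0 (x ∷ xs) = ℤP.≤-trans (max≥0 xs) (ℤP.i≤j⊔i x _)

≤-max : ∀ (f : ℕ → ℤ) xs {x} → x ∈ xs → f x ≤ foldr _⊔_ 0ℤ (map f xs)
≤-max f (y ∷ xs) (here refl) = ℤP.i≤i⊔j (f y) _
≤-max f (y ∷ xs) (there m) = ℤP.≤-trans (≤-max f xs m) (ℤP.i≤j⊔i (f y) _)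

max-lub : ∀ (f : ℕ → ℤ) xs {b} → 0ℤ ≤ b → (∀ x → x ∈ xs → f x ≤ b) → foldr _⊔_ 0ℤ (map f xs) ≤ b
max-lub f [] b≥0 _ = b≥0
max-lub f (y ∷ xs) b≥0 H = ℤP.⊔-lub (H y (here refl)) (max-lub f xs b≥0 (λ x m → H x (there m)))

stepIndexing : ∀ π π' I → Indexing π I → π ⟶ π' →
  ∃ λ J → Indexing π' J × (∀ y → y ∈ edges π' → ∃ λ x → x ∈ edges π × J y ≡ I x)
stepIndexing π π' I (idx , conclI) (st , sameConcl) =
  index tr , (indexes tr , conclJ) , λ y m → inherits tr m
  where
  tr = transport st (λ m → m) idx
  conclJ : ∀ x y → x ∈ concl π' → y ∈ concl π' → index tr x ≡ index tr y
  conclJ x y mx my =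
    trans (agrees tr (concl⊆edges (seq π) mx'))
          (trans (conclI x y mx' my') (sym (agrees tr (concl⊆edges (seq π) my'))))
    where
    mx' = subst (x ∈_) sameConcl mx
    my' = subst (y ∈_) sameConcl my

canonicalBelow : ∀ π π' I J → (∀ x → x ∈ edges π → 0ℤ ≤ I x) → Indexing π' J →
  (∀ y → y ∈ edges π' → ∃ λ x → x ∈ edges π × J y ≡ I x) →
  Σ (ℕ → ℤ) λ I' → Canonical π' I' × level π' I' ≤ level π I
canonicalBelow π π' I J I≥0 idxJ inherited =
  let (I' , canonical , I'≤J) = normalise π' J idxJ J≥0
  in I' , canonical , max-lub I' (edges π') (max≥0 (map I (edges π))) (bounded I' I'≤J)
  where
  J≥0 : ∀ y → y ∈ edges π' → 0ℤ ≤ J y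
  J≥0 y m = let (x , mx , e) = inherited y m in subst (0ℤ ≤_) (sym e) (I≥0 x mx)
  bounded : ∀ I' → (∀ y → y ∈ edges π' → I' y ≤ J y) → ∀ y → y ∈ edges π' → I' y ≤ level π I
  bounded I' I'≤J y m = let (x , mx , e) = inherited y m in
    ℤP.≤-trans (I'≤J y m) (subst (_≤ level π I) (sym e) (≤-max I (edges π) mx))

mainTheorem10 : (π π' : Net) (I : ℕ → ℤ) → Canonical π I → π ⟶ π' →
    Σ (ℕ → ℤ) (λ I' → Canonical π' I' × level π' I' ≤ level π I)
mainTheorem10 π π' I (idx , I≥0 , _) st =
  let (J , idxJ , inherited) = stepIndexing π π' I idx st
  in canonicalBelow π π' I J I≥0 idxJ inherited
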